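{- Let $G$ be a finite abelian group of exponent $n$. Then for every integer $j$ with $1\leqslant j\leqslant n$, $$\eta(G)+j-1\leqslant \mathsf{s}_{[\![j,n]\!]}(G)\leqslant \mathsf{s}(G)-n+j.$$ In particular, if $\mathsf{s}(G)=\eta(G)+n-1$, then $\mathsf{s}_{[\![j,n]\!]}(G)=\eta(G)+j-1$ for every $j$ with $1\leqslant j\leqslant n$.
   Context: $[\![a,b]\!]=\{x\in\mathbb{Z}: a\leqslant x\leqslant b\}$. A sequence over $G$ is a finite list of elements of $G$ (repetitions allowed, order irrelevant), with length and sum defined in the obvious way; a subsequence is a sub-multiset. For $L\subseteq\{1,2,\dots\}$, $\mathsf{s}_L(G)$ is the smallest positive integer $N$ such that every sequence over $G$ of length at least $N$ contains a subsequence $T$ with sum $0$ and $|T|\in L$. Then $\eta(G)=\mathsf{s}_{[\![1,n]\!]}(G)$ and $\mathsf{s}(G)=\mathsf{s}_{\{n\}}(G)$ (the Erdős–Ginzburg–Ziv constant). -}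

module Defs where

open import Level using (Level; _⊔_)
open import Algebra.Bundles using (AbelianGroup)
open import Data.Nat using (ℕ; zero; suc; _≤_; _+_)
open import Data.List using (List; []; _∷_; length; foldr)
open import Data.List.Relation.Binary.Sublist.Propositional using (_⊆_)
import Data.List.Membership.Setoid
open import Data.Product using (Σ; _×_; ∃)

module _ {c ℓ : Level} (G : AbelianGroup c ℓ) where
  open AbelianGroup G

  mul : ℕ → Carrier → Carrier
  mul zero    g = ε
  mul (suc n) g = g ∙ mul n g

  σ : List Carrier → Carrier
  σ = foldr _∙_ ε

  IsFinite : Set (c ⊔ ℓ)
  IsFinite = Σ (List Carrier) λ xs → ∀ g → g ∈ₛ xs
    where _∈ₛ_ = Data.List.Membership.Setoid._∈_ setoid

  IsExponent : ℕ → Set (c ⊔ ℓ)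
  IsExponent n =
    1 ≤ n × (∀ g → mul n g ≈ ε) ×
    (∀ m → 1 ≤ m → (∀ g → mul m g ≈ ε) → n ≤ m)

  -- every sequence of length ≥ N has a zero-sum subsequence T
  -- (sub-multiset = choice of positions = sublist) with |T| ∈ L
  HasProp : (L : ℕ → Set) → ℕ → Set (c ⊔ ℓ)
  HasProp L N = ∀ (S : List Carrier) → N ≤ length S →
    Σ (List Carrier) λ T → T ⊆ S × L (length T) × σ T ≈ ε

  IsSL : (L : ℕ → Set) → ℕ → Set (c ⊔ ℓ)
  IsSL L N = 1 ≤ N × HasProp L N × (∀ M → 1 ≤ M → HasProp L M → N ≤ M)

⟦_,_⟧ : ℕ → ℕ → ℕ → Set
⟦ a , b ⟧ x = a ≤ x × x ≤ b

-- Padding a sequence with k zeros shifts the admissible lengths down by k: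
-- if every sequence of length ≥ N has a zero-sum subsequence with length in
-- [a + k, b], then every sequence of length ≥ N − k has one with length in
-- [a, b] (delete the padding zeros from the subsequence found in S 0^k).
-- Hence s_[a,b] + k ≤ s_[a+k,b].  With a = 1, k = j − 1 this is the lower
-- bound, with a = j, k = n − j the upper bound; the second part follows by
-- antisymmetry.
module Submission where

open import Defs
open import Level using (Level)
open import Algebra.Bundles using (AbelianGroup)
open import Data.Nat using (ℕ; zero; suc; _≤_; _+_; _∸_; z≤n; s≤s)
open import Data.Nat.Properties
open import Data.Nat.Tactic.RingSolver using (solve-∀)
open import Data.Product using (Σ; _×_; _,_; proj₁; proj₂)
open import Data.List using (List; []; _∷_; length; _++_; replicate)
open import Data.List.Properties using (length-++; length-replicate)
open import Data.List.Relation.Binary.Sublist.Propositional using (_⊆_; []; _∷_; _∷ʳ_)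
open import Data.List.Relation.Binary.Sublist.Propositional.Properties using (length-mono-≤)
open import Relation.Binary.PropositionalEquality using (_≡_; refl; sym; cong; subst)

module _ {c ℓ : Level} (G : AbelianGroup c ℓ) where
  open AbelianGroup G using (Carrier; ε; _≈_; ∙-congˡ; identityˡ)
    renaming (refl to ≈-refl; sym to ≈-sym; trans to ≈-trans)

  σ-⊆-replicate-ε : ∀ k {T : List Carrier} → T ⊆ replicate k ε → σ G T ≈ ε
  σ-⊆-replicate-ε zero    []          = ≈-refl
  σ-⊆-replicate-ε (suc k) (_ ∷ʳ T⊆)   = σ-⊆-replicate-ε k T⊆
  σ-⊆-replicate-ε (suc k) (refl ∷ T⊆) =
    ≈-trans (∙-congˡ (σ-⊆-replicate-ε k T⊆)) (identityˡ ε)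

  ⊆-strip-replicate-ε : ∀ k (S : List Carrier) {T : List Carrier} →
    T ⊆ S ++ replicate k ε →
    Σ (List Carrier) λ T′ → T′ ⊆ S × σ G T′ ≈ σ G T ×
      length T ≤ length T′ + k × length T′ ≤ length T
  ⊆-strip-replicate-ε k []      {T} T⊆ =
    [] , [] , ≈-sym (σ-⊆-replicate-ε k T⊆) ,
    subst (length T ≤_) (length-replicate k) (length-mono-≤ T⊆) , z≤n
  ⊆-strip-replicate-ε k (x ∷ S) (_ ∷ʳ T⊆) with ⊆-strip-replicate-ε k S T⊆
  ... | T′ , T′⊆ , σ≈ , long , short = T′ , x ∷ʳ T′⊆ , σ≈ , long , short
  ⊆-strip-replicate-ε k (x ∷ S) (refl ∷ T⊆) with ⊆-strip-replicate-ε k S T⊆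
  ... | T′ , T′⊆ , σ≈ , long , short =
    x ∷ T′ , refl ∷ T′⊆ , ∙-congˡ σ≈ , s≤s long , s≤s short

  HasProp⇒lower≤ : ∀ {a b} N → HasProp G ⟦ a , b ⟧ N → a ≤ N
  HasProp⇒lower≤ N P with P (replicate N ε) (≤-reflexive (sym (length-replicate N)))
  ... | T , T⊆ , (a≤|T| , _) , _ =
    ≤-trans a≤|T| (subst (length T ≤_) (length-replicate N) (length-mono-≤ T⊆))

  HasProp-shift : ∀ {a b} k N → HasProp G ⟦ a + k , b ⟧ N → HasProp G ⟦ a , b ⟧ (N ∸ k)
  HasProp-shift {a} k N P S N∸k≤|S| with P (S ++ replicate k ε) N≤|padded|
    where
    N≤|padded| : N ≤ length (S ++ replicate k ε)
    N≤|padded| rewrite length-++ S {replicate k ε} | length-replicate k {ε} =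
      ≤-trans (m≤n+m∸n N k) (≤-trans (+-monoʳ-≤ k N∸k≤|S|) (≤-reflexive (+-comm k (length S))))
  ... | T , T⊆ , (a+k≤|T| , |T|≤b) , σT≈ε with ⊆-strip-replicate-ε k S T⊆
  ... | T′ , T′⊆ , σ≈ , long , short =
    T′ , T′⊆ , (+-cancelʳ-≤ k a (length T′) (≤-trans a+k≤|T| long) , ≤-trans short |T|≤b) ,
    ≈-trans σ≈ σT≈ε

  IsSL-shift-≤ : ∀ {a b M} k N → 1 ≤ a →
    IsSL G ⟦ a , b ⟧ M → HasProp G ⟦ a + k , b ⟧ N → M + k ≤ N
  IsSL-shift-≤ {a} k N 1≤a (_ , _ , minimal) P =
    m≤o∸n⇒m+n≤o _ (m+n≤o⇒n≤o a (HasProp⇒lower≤ N P))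
      (minimal (N ∸ k) (≤-trans 1≤a (HasProp⇒lower≤ (N ∸ k) shifted)) shifted)
    where
    shifted : HasProp G ⟦ a , _ ⟧ (N ∸ k)
    shifted = HasProp-shift k N P

+-suc-∸1-swap : ∀ m n p → m + suc n ∸ 1 + suc p ≡ m + suc p ∸ 1 + suc n
+-suc-∸1-swap m n p rewrite +-suc m n | +-suc m p = swap m n p
  where
  swap : ∀ m n p → m + n + suc p ≡ m + p + suc n
  swap = solve-∀

corollary6p1 : {c ℓ : Level} (G : AbelianGroup c ℓ) → IsFinite G →
    (n : ℕ) → IsExponent G n →
    (η s : ℕ) → IsSL G ⟦ 1 , n ⟧ η → IsSL G ⟦ n , n ⟧ s →
    ((j : ℕ) → 1 ≤ j → j ≤ n → (sj : ℕ) → IsSL G ⟦ j , n ⟧ sj →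
      (η + j ∸ 1 ≤ sj) × (sj + n ≤ s + j))
    ×
    (s ≡ η + n ∸ 1 → (j : ℕ) → 1 ≤ j → j ≤ n → (sj : ℕ) → IsSL G ⟦ j , n ⟧ sj →
      sj ≡ η + j ∸ 1)
corollary6p1 G _ n _ η s η-sL (_ , s-prop , _) = bounds , equality
  where
  bounds : (j : ℕ) → 1 ≤ j → j ≤ n → (sj : ℕ) → IsSL G ⟦ j , n ⟧ sj →
    (η + j ∸ 1 ≤ sj) × (sj + n ≤ s + j)
  bounds (suc j) _ j<n sj sj-sL@(_ , sj-prop , _) = lower , upper
    where
    lower : η + suc j ∸ 1 ≤ sj
    lower = subst (_≤ sj) (sym (cong (_∸ 1) (+-suc η j)))
      (IsSL-shift-≤ G j sj (s≤s z≤n) η-sL sj-prop)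
    s-prop′ : HasProp G ⟦ suc j + (n ∸ suc j) , n ⟧ s
    s-prop′ = subst (λ a → HasProp G ⟦ a , n ⟧ s) (sym (m+[n∸m]≡n j<n)) s-prop
    upper : sj + n ≤ s + suc j
    upper = begin
      sj + n                      ≡⟨ cong (sj +_) (m∸n+n≡m j<n) ⟨
      sj + (n ∸ suc j + suc j)    ≡⟨ +-assoc sj (n ∸ suc j) (suc j) ⟨
      sj + (n ∸ suc j) + suc j    ≤⟨ +-monoˡ-≤ (suc j) (IsSL-shift-≤ G (n ∸ suc j) s (s≤s z≤n) sj-sL s-prop′) ⟩
      s + suc j                   ∎
      where open ≤-Reasoning

  equality : s ≡ η + n ∸ 1 → (j : ℕ) → 1 ≤ j → j ≤ n → (sj : ℕ) → IsSL G ⟦ j , n ⟧ sj →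
    sj ≡ η + j ∸ 1
  equality refl (suc j) 1≤j j<n@(s≤s {n = n-1} _) sj sj-sL =
    ≤-antisym (+-cancelʳ-≤ n sj (η + suc j ∸ 1) sj+n≤) (proj₁ sj-bounds)
    where
    sj-bounds : (η + suc j ∸ 1 ≤ sj) × (sj + n ≤ s + suc j)
    sj-bounds = bounds (suc j) 1≤j j<n sj sj-sL
    sj+n≤ : sj + n ≤ η + suc j ∸ 1 + n
    sj+n≤ = subst (sj + n ≤_) (+-suc-∸1-swap η n-1 j) (proj₂ sj-bounds)
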